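{- For all finite multisets of formulas $\Gamma,\Delta$ and every formula $\phi$: if $\vdash_{\mathrm{i}\mathsf{GL}_{\mathrm{fin}}} \Gamma,\Box\Gamma,\Box\Delta,\Box\phi \Rightarrow \phi$, then $\vdash_{\mathrm{i}\mathsf{GL}_{\mathrm{fin}}} \Gamma,\Box\Gamma,\Box\Delta \Rightarrow \phi$. That is, the rule $$\frac{\Gamma,\Box\Gamma,\Box\Delta,\Box\phi\Rightarrow\phi}{\Gamma,\Box\Gamma,\Box\Delta\Rightarrow\phi}\ (\text{Löb})$$ is admissible in $\mathrm{i}\mathsf{GL}_{\mathrm{fin}}$.
   Context: Formulas are built from propositional variables $p$ and $\bot$ using $\to,\wedge,\vee$ and the unary modality $\Box$. A sequent $\Gamma\Rightarrow\phi$ consists of a finite multiset $\Gamma$ of formulas and a single formula $\phi$. For a multiset $\Gamma$, $\Box\Gamma$ is the multiset $\{\Box\psi:\psi\in\Gamma\}$. The rules of $\mathrm{i}\mathsf{GL}_{\mathrm{Seq}}$ are (with $\Gamma,\Pi$ arbitrary multisets, $p$ a variable): Prop: $\Gamma,p\Rightarrow p$ (no premises); Absurd: $\Gamma,\bot\Rightarrow\phi$ (no premises); $(\wedge L)$: from $\Gamma,\phi,\psi\Rightarrow\chi$ infer $\Gamma,\phi\wedge\psi\Rightarrow\chi$; $(\wedge R)$: from $\Gamma\Rightarrow\phi$ and $\Gamma\Rightarrow\psi$ infer $\Gamma\Rightarrow\phi\wedge\psi$; $(\vee L)$: from $\Gamma,\phi\Rightarrow\chi$ and $\Gamma,\psi\Rightarrow\chi$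 infer $\Gamma,\phi\vee\psi\Rightarrow\chi$; $(\vee R_0)$: from $\Gamma\Rightarrow\phi$ infer $\Gamma\Rightarrow\phi\vee\psi$; $(\vee R_1)$: from $\Gamma\Rightarrow\psi$ infer $\Gamma\Rightarrow\phi\vee\psi$; $(\to L)$: from $\Gamma,\phi\to\psi\Rightarrow\phi$ and $\Gamma,\psi\Rightarrow\chi$ infer $\Gamma,\phi\to\psi\Rightarrow\chi$; $(\to R)$: from $\Gamma,\phi\Rightarrow\psi$ infer $\Gamma\Rightarrow\phi\to\psi$; $\mathrm{R}_{\mathsf{GL}}$: from $\Gamma,\Box\Gamma,\Box\phi\Rightarrow\phi$ infer $\Pi,\Box\Gamma\Rightarrow\Box\phi$. A sequent is provable in $\mathrm{i}\mathsf{GL}_{\mathrm{fin}}$, written $\vdash_{\mathrm{i}\mathsf{GL}_{\mathrm{fin}}}\Gamma\Rightarrow\phi$, iff there is a finite proof tree in these rules (every node is an instance of one of the rules, its children being the premises) with root $\Gamma\Rightarrow\phi$. A rule is admissible if whenever its premise is provable, so is its conclusion. -}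

module Defs where

open import Data.Nat using (ℕ)
open import Data.List using (List; []; _∷_; _++_; map)
open import Relation.Binary.PropositionalEquality using (_≡_)
open import Data.List.Relation.Binary.Permutation.Propositional using (_↭_)

data Form : Set where
  var  : ℕ → Form
  ⊥'   : Form
  _⇒_  : Form → Form → Form
  _∧'_ : Form → Form → Form
  _∨'_ : Form → Form → Form
  □_   : Form → Form

infixr 5 _⇒_
infixr 6 _∨'_
infixr 7 _∧'_
infix 8 □_

-- Finite multisets are represented as lists, taken up to permutation (_↭_).
Ctx : Set
Ctx = List Form

□ctx : Ctx → Ctx
□ctx = map □_

-- Provability in iGL_fin: finite proof trees (inductive type).
-- Every rule's conclusion context is any list that is a permutation of
-- the rule's pattern, so contexts behave exactly as multisets.
data _⊢_ : Ctx → Form → Set where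
  Prop   : ∀ {Δ} Γ p → Δ ↭ (var p ∷ Γ) → Δ ⊢ var p
  Absurd : ∀ {Δ} Γ φ → Δ ↭ (⊥' ∷ Γ) → Δ ⊢ φ
  ∧L     : ∀ {Δ} Γ φ ψ χ → Δ ↭ ((φ ∧' ψ) ∷ Γ) →
           (φ ∷ ψ ∷ Γ) ⊢ χ → Δ ⊢ χ
  ∧R     : ∀ Γ φ ψ → Γ ⊢ φ → Γ ⊢ ψ → Γ ⊢ (φ ∧' ψ)
  ∨L     : ∀ {Δ} Γ φ ψ χ → Δ ↭ ((φ ∨' ψ) ∷ Γ) →
           (φ ∷ Γ) ⊢ χ → (ψ ∷ Γ) ⊢ χ → Δ ⊢ χ
  ∨R₀    : ∀ Γ φ ψ → Γ ⊢ φ → Γ ⊢ (φ ∨' ψ)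
  ∨R₁    : ∀ Γ φ ψ → Γ ⊢ ψ → Γ ⊢ (φ ∨' ψ)
  ⇒L     : ∀ {Δ} Γ φ ψ χ → Δ ↭ ((φ ⇒ ψ) ∷ Γ) →
           ((φ ⇒ ψ) ∷ Γ) ⊢ φ → (ψ ∷ Γ) ⊢ χ → Δ ⊢ χ
  ⇒R     : ∀ Γ φ ψ → (φ ∷ Γ) ⊢ ψ → Γ ⊢ (φ ⇒ ψ)
  RGL    : ∀ {Δ} Π Γ φ → Δ ↭ (Π ++ □ctx Γ) →
           (Γ ++ □ctx Γ ++ (□ φ ∷ [])) ⊢ φ → Δ ⊢ (□ φ)

infix 4 _⊢_

module Submission where

-- The Löb rule is a cut: weakening the premise to Γ,Δ,□Γ,□Δ,□φ ⇒ φ, the GL rule gives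
-- Γ,□Γ,□Δ ⇒ □φ, and cutting □φ against the premise gives Γ,□Γ,□Δ ⇒ φ.
--
-- Cut is admissible in the equivalent calculus _⊢ˢ_, whose left rules keep their principal
-- formula and whose contexts matter only up to membership. The proof is by induction on
-- the cut formula, then on the number of formulas □A, with A in a fixed subformula-closed
-- universe, that are missing from the context, then on the right premise. The middle
-- measure handles the case where both premises end in the GL rule: unless □D is already
-- in the context Ψ (an axiom), the cut moves into the premise □D,U,□U ⇒ D of a new GL
-- rule, where U = {A ∣ □A ∈ Ψ}, and that context holds every box of Ψ and also □D.

open import Data.Empty using (⊥; ⊥-elim)
open import Data.List using (List; []; _∷_; _++_; [_]; map; length; filter; concatMap)
open import Data.List.Properties using (map-++)
open import Data.List.Membership.Propositional using (_∈_; _∉_)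
open import Data.List.Membership.Propositional.Properties
  using (∈-++⁺ʳ; ∈-++⁻; ∈-map⁺; ∈-map⁻; ∈-∃++; ∈-concatMap⁺; ∈-concatMap⁻)
open import Data.List.Relation.Binary.Permutation.Propositional
  using (_↭_; ↭-refl; ↭-sym; ↭-trans; prep; swap)
open import Data.List.Relation.Binary.Permutation.Propositional.Properties using (∈-resp-↭; shift)
open import Data.List.Relation.Binary.Subset.Propositional using (_⊆_)
open import Data.List.Relation.Binary.Subset.Propositional.Properties
  using (⊆-refl; ⊆-trans; ⊆-reflexive; ⊆-reflexive-↭; map⁺; xs⊆x∷xs; ∷⁺ʳ; ∈-∷⁺ʳ; ⊆∷∧∉⇒⊆;
         xs⊆xs++ys; xs⊆ys++xs; ++⁺; ++⁺ʳ)
open import Data.List.Relation.Unary.All as All using (All; _∷_)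
open import Data.List.Relation.Unary.Any as Any using (Any; here; there)
open import Data.Nat as ℕ using (ℕ; suc; _≤_; _<_; s≤s; z≤n)
open import Data.Nat.Properties using (≤-refl; ≤-trans; <-≤-trans; ≤-<-trans; m≤n⇒m≤1+n)
open import Data.Product using (_×_; _,_; ∃-syntax; uncurry)
open import Data.Sum using (_⊎_; inj₁; inj₂)
open import Function using (_∘_)
open import Level using (Level)
open import Relation.Binary.Definitions using (DecidableEquality)
open import Relation.Binary.PropositionalEquality using (_≡_; _≢_; refl; cong; cong₂)
open import Relation.Nullary using (yes; no; ¬_; ¬?; contradiction)
open import Relation.Nullary.Decidable using (map′; _×-dec_)
open import Relation.Unary using (Pred; Decidable)

open import Defs

variable
  A B C D E K : Form
  Γ Δ Θ Ψ Φ Φ′ : Ctx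
  n : ℕ

++-lub : ∀ Φ → Φ ⊆ Γ → Ψ ⊆ Γ → Φ ++ Ψ ⊆ Γ
++-lub Φ Φ⊆ Ψ⊆ m with ∈-++⁻ Φ m
... | inj₁ m′ = Φ⊆ m′
... | inj₂ m′ = Ψ⊆ m′

module _ {a p q : Level} {X : Set a} {P : Pred X p} {Q : Pred X q}
         (P? : Decidable P) (Q? : Decidable Q) (P⇒Q : ∀ {x} → P x → Q x) where

  length-filter-mono : ∀ xs → length (filter P? xs) ≤ length (filter Q? xs)
  length-filter-mono [] = z≤n
  length-filter-mono (x ∷ xs) with P? x | Q? x
  ... | yes _ | yes _ = s≤s (length-filter-mono xs)
  ... | yes p | no ¬q = contradiction (P⇒Q p) ¬q
  ... | no _  | yes _ = m≤n⇒m≤1+n (length-filter-mono xs)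
  ... | no _  | no _  = length-filter-mono xs

  length-filter-strict : ∀ {xs} → Any (λ x → Q x × ¬ P x) xs →
                         length (filter P? xs) < length (filter Q? xs)
  length-filter-strict {x ∷ xs} (here (q , ¬p)) with P? x | Q? x
  ... | yes p | _     = contradiction p ¬p
  ... | no _  | yes _ = s≤s (length-filter-mono xs)
  ... | no _  | no ¬q = contradiction q ¬q
  length-filter-strict {x ∷ xs} (there w) with P? x | Q? x
  ... | yes _ | yes _ = s≤s (length-filter-strict w)
  ... | yes p | no ¬q = contradiction (P⇒Q p) ¬q
  ... | no _  | yes _ = m≤n⇒m≤1+n (length-filter-strict w)
  ... | no _  | no _  = length-filter-strict w

_≟_ : DecidableEquality Form
var m ≟ var n = map′ (cong var) (λ { refl → refl }) (m ℕ.≟ n)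
⊥' ≟ ⊥' = yes refl
(A ⇒ B) ≟ (C ⇒ D) = map′ (uncurry (cong₂ _⇒_)) (λ { refl → refl , refl }) (A ≟ C ×-dec B ≟ D)
(A ∧' B) ≟ (C ∧' D) = map′ (uncurry (cong₂ _∧'_)) (λ { refl → refl , refl }) (A ≟ C ×-dec B ≟ D)
(A ∨' B) ≟ (C ∨' D) = map′ (uncurry (cong₂ _∨'_)) (λ { refl → refl , refl }) (A ≟ C ×-dec B ≟ D)
(□ A) ≟ (□ C) = map′ (cong □_) (λ { refl → refl }) (A ≟ C)
var _ ≟ ⊥' = no λ ()
var _ ≟ (_ ⇒ _) = no λ ()
var _ ≟ (_ ∧' _) = no λ ()
var _ ≟ (_ ∨' _) = no λ ()
var _ ≟ (□ _) = no λ ()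
⊥' ≟ var _ = no λ ()
⊥' ≟ (_ ⇒ _) = no λ ()
⊥' ≟ (_ ∧' _) = no λ ()
⊥' ≟ (_ ∨' _) = no λ ()
⊥' ≟ (□ _) = no λ ()
(_ ⇒ _) ≟ var _ = no λ ()
(_ ⇒ _) ≟ ⊥' = no λ ()
(_ ⇒ _) ≟ (_ ∧' _) = no λ ()
(_ ⇒ _) ≟ (_ ∨' _) = no λ ()
(_ ⇒ _) ≟ (□ _) = no λ ()
(_ ∧' _) ≟ var _ = no λ ()
(_ ∧' _) ≟ ⊥' = no λ ()
(_ ∧' _) ≟ (_ ⇒ _) = no λ ()
(_ ∧' _) ≟ (_ ∨' _) = no λ ()
(_ ∧' _) ≟ (□ _) = no λ ()
(_ ∨' _) ≟ var _ = no λ ()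
(_ ∨' _) ≟ ⊥' = no λ ()
(_ ∨' _) ≟ (_ ⇒ _) = no λ ()
(_ ∨' _) ≟ (_ ∧' _) = no λ ()
(_ ∨' _) ≟ (□ _) = no λ ()
(□ _) ≟ var _ = no λ ()
(□ _) ≟ ⊥' = no λ ()
(□ _) ≟ (_ ⇒ _) = no λ ()
(□ _) ≟ (_ ∧' _) = no λ ()
(□ _) ≟ (_ ∨' _) = no λ ()

open import Data.List.Membership.DecPropositional _≟_ using (_∈?_)

infix 4 _≺_
data _≺_ : Form → Form → Set where
  ≺⇒ˡ : A ≺ A ⇒ B
  ≺⇒ʳ : B ≺ A ⇒ B
  ≺∧ˡ : A ≺ A ∧' B
  ≺∧ʳ : B ≺ A ∧' B
  ≺∨ˡ : A ≺ A ∨' B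
  ≺∨ʳ : B ≺ A ∨' B
  ≺□  : A ≺ □ A

subformulas : Form → List Form
properSubformulas : Form → List Form
subformulas A = A ∷ properSubformulas A
properSubformulas (A ⇒ B) = subformulas A ++ subformulas B
properSubformulas (A ∧' B) = subformulas A ++ subformulas B
properSubformulas (A ∨' B) = subformulas A ++ subformulas B
properSubformulas (□ A) = subformulas A
properSubformulas _ = []

≺⇒∈subformulas : A ≺ B → A ∈ subformulas B
≺⇒∈subformulas {B = A ⇒ C} ≺⇒ˡ = there (xs⊆xs++ys (subformulas A) (subformulas C) (here refl))
≺⇒∈subformulas {B = A ⇒ C} ≺⇒ʳ = there (xs⊆ys++xs (subformulas C) (subformulas A) (here refl))
≺⇒∈subformulas {B = A ∧' C} ≺∧ˡ = there (xs⊆xs++ys (subformulas A) (subformulas C) (here refl))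
≺⇒∈subformulas {B = A ∧' C} ≺∧ʳ = there (xs⊆ys++xs (subformulas C) (subformulas A) (here refl))
≺⇒∈subformulas {B = A ∨' C} ≺∨ˡ = there (xs⊆xs++ys (subformulas A) (subformulas C) (here refl))
≺⇒∈subformulas {B = A ∨' C} ≺∨ʳ = there (xs⊆ys++xs (subformulas C) (subformulas A) (here refl))
≺⇒∈subformulas ≺□ = there (here refl)

subformulas-trans : A ∈ subformulas B → subformulas A ⊆ subformulas B
subformulas-trans₂ : ∀ B C → A ∈ subformulas B ++ subformulas C →
                     subformulas A ⊆ subformulas B ++ subformulas C
subformulas-trans (here refl) = ⊆-refl
subformulas-trans {B = B ⇒ C} (there m) = there ∘ subformulas-trans₂ B C m
subformulas-trans {B = B ∧' C} (there m) = there ∘ subformulas-trans₂ B C m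
subformulas-trans {B = B ∨' C} (there m) = there ∘ subformulas-trans₂ B C m
subformulas-trans {B = □ B} (there m) = there ∘ subformulas-trans m
subformulas-trans₂ B C m with ∈-++⁻ (subformulas B) m
... | inj₁ m′ = ⊆-trans (subformulas-trans m′) (xs⊆xs++ys (subformulas B) (subformulas C))
... | inj₂ m′ = ⊆-trans (subformulas-trans m′) (xs⊆ys++xs (subformulas C) (subformulas B))

SubformulaClosed : Ctx → Set
SubformulaClosed L = ∀ {A B} → A ≺ B → B ∈ L → A ∈ L

subformulasOf : Ctx → Ctx
subformulasOf = concatMap subformulas

⊆-subformulasOf : ∀ Γ → Γ ⊆ subformulasOf Γ
⊆-subformulasOf Γ m = ∈-concatMap⁺ subformulas {xs = Γ} (Any.map (λ { refl → here refl }) m)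

subformulasOf-closed : ∀ Γ → SubformulaClosed (subformulasOf Γ)
subformulasOf-closed Γ A≺B m =
  ∈-concatMap⁺ subformulas {xs = Γ}
    (Any.map (λ B∈C → subformulas-trans B∈C (≺⇒∈subformulas A≺B)) (∈-concatMap⁻ subformulas m))

data BoxView : Form → Set where
  boxed   : ∀ A → BoxView (□ A)
  unboxed : (∀ A → B ≢ □ A) → BoxView B

boxView : ∀ A → BoxView A
boxView (□ A) = boxed A
boxView (var _) = unboxed λ _ ()
boxView ⊥' = unboxed λ _ ()
boxView (_ ⇒ _) = unboxed λ _ ()
boxView (_ ∧' _) = unboxed λ _ ()
boxView (_ ∨' _) = unboxed λ _ ()

unbox : Ctx → Ctx
unbox [] = []
unbox (A ∷ Γ) with boxView A
... | boxed B = B ∷ unbox Γ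
... | unboxed _ = unbox Γ

nonboxed : Ctx → Ctx
nonboxed [] = []
nonboxed (A ∷ Γ) with boxView A
... | boxed _ = nonboxed Γ
... | unboxed _ = A ∷ nonboxed Γ

split-boxes : ∀ Γ → Γ ↭ nonboxed Γ ++ □ctx (unbox Γ)
split-boxes [] = ↭-refl
split-boxes (A ∷ Γ) with boxView A
... | boxed B = ↭-trans (prep (□ B) (split-boxes Γ)) (↭-sym (shift (□ B) (nonboxed Γ) _))
... | unboxed _ = prep A (split-boxes Γ)

∈-unbox⁺ : □ A ∈ Γ → A ∈ unbox Γ
∈-unbox⁺ {Γ = B ∷ Γ} m with boxView B | m
... | boxed _ | here refl = here refl
... | boxed _ | there m′ = there (∈-unbox⁺ m′)
... | unboxed B≢□ | here refl = ⊥-elim (B≢□ _ refl)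
... | unboxed _ | there m′ = ∈-unbox⁺ m′

∈-unbox⁻ : A ∈ unbox Γ → □ A ∈ Γ
∈-unbox⁻ {Γ = B ∷ Γ} m with boxView B | m
... | boxed _ | here refl = here refl
... | boxed _ | there m′ = there (∈-unbox⁻ m′)
... | unboxed _ | m′ = there (∈-unbox⁻ m′)

□ctx⊆⇒⊆unbox : □ctx Φ ⊆ Γ → Φ ⊆ unbox Γ
□ctx⊆⇒⊆unbox Φ⊆ = ∈-unbox⁺ ∘ Φ⊆ ∘ ∈-map⁺ □_

□ctx-unbox⊆ : □ctx (unbox Γ) ⊆ Γ
□ctx-unbox⊆ m with ∈-map⁻ □_ m
... | _ , A∈ , refl = ∈-unbox⁻ A∈

-- A calculus with set-like contexts

infix 4 _⊢ˢ_
data _⊢ˢ_ : Ctx → Form → Set where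
  ax  : ∀ {p} → var p ∈ Γ → Γ ⊢ˢ var p
  ⊥ₗ  : ⊥' ∈ Γ → Γ ⊢ˢ C
  ∧ₗ  : A ∧' B ∈ Γ → A ∷ B ∷ Γ ⊢ˢ C → Γ ⊢ˢ C
  ∧ᵣ  : Γ ⊢ˢ A → Γ ⊢ˢ B → Γ ⊢ˢ A ∧' B
  ∨ₗ  : A ∨' B ∈ Γ → A ∷ Γ ⊢ˢ C → B ∷ Γ ⊢ˢ C → Γ ⊢ˢ C
  ∨ᵣ₀ : Γ ⊢ˢ A → Γ ⊢ˢ A ∨' B
  ∨ᵣ₁ : Γ ⊢ˢ B → Γ ⊢ˢ A ∨' B
  ⇒ₗ  : A ⇒ B ∈ Γ → Γ ⊢ˢ A → B ∷ Γ ⊢ˢ C → Γ ⊢ˢ C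
  ⇒ᵣ  : A ∷ Γ ⊢ˢ B → Γ ⊢ˢ A ⇒ B
  □ᵣ  : ∀ Φ → □ctx Φ ⊆ Γ → □ A ∷ Φ ++ □ctx Φ ⊢ˢ A → Γ ⊢ˢ □ A

weaken : Γ ⊆ Δ → Γ ⊢ˢ C → Δ ⊢ˢ C
weaken Γ⊆Δ (ax m) = ax (Γ⊆Δ m)
weaken Γ⊆Δ (⊥ₗ m) = ⊥ₗ (Γ⊆Δ m)
weaken Γ⊆Δ (∧ₗ m d) = ∧ₗ (Γ⊆Δ m) (weaken (∷⁺ʳ _ (∷⁺ʳ _ Γ⊆Δ)) d)
weaken Γ⊆Δ (∧ᵣ d e) = ∧ᵣ (weaken Γ⊆Δ d) (weaken Γ⊆Δ e)
weaken Γ⊆Δ (∨ₗ m d e) = ∨ₗ (Γ⊆Δ m) (weaken (∷⁺ʳ _ Γ⊆Δ) d) (weaken (∷⁺ʳ _ Γ⊆Δ) e)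
weaken Γ⊆Δ (∨ᵣ₀ d) = ∨ᵣ₀ (weaken Γ⊆Δ d)
weaken Γ⊆Δ (∨ᵣ₁ d) = ∨ᵣ₁ (weaken Γ⊆Δ d)
weaken Γ⊆Δ (⇒ₗ m d e) = ⇒ₗ (Γ⊆Δ m) (weaken Γ⊆Δ d) (weaken (∷⁺ʳ _ Γ⊆Δ) e)
weaken Γ⊆Δ (⇒ᵣ d) = ⇒ᵣ (weaken (∷⁺ʳ _ Γ⊆Δ) d)
weaken Γ⊆Δ (□ᵣ Φ Φ⊆ d) = □ᵣ Φ (⊆-trans Φ⊆ Γ⊆Δ) d

identity : ∀ A → A ∈ Γ → Γ ⊢ˢ A
identity (var _) m = ax m
identity ⊥' m = ⊥ₗ m
identity (A ⇒ B) m = ⇒ᵣ (⇒ₗ (there m) (identity A (here refl)) (identity B (here refl)))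
identity (A ∧' B) m = ∧ₗ m (∧ᵣ (identity A (here refl)) (identity B (there (here refl))))
identity (A ∨' B) m = ∨ₗ m (∨ᵣ₀ (identity A (here refl))) (∨ᵣ₁ (identity B (here refl)))
identity (□ A) m = □ᵣ [ A ] (λ { (here refl) → m }) (identity A (there (here refl)))

-- Equivalence with the multiset calculus

principal : Δ ↭ A ∷ Γ → A ∈ Δ
principal π = ∈-resp-↭ (↭-sym π) (here refl)

side : Δ ↭ A ∷ Γ → Γ ⊆ Δ
side π = ⊆-trans (xs⊆x∷xs _ _) (⊆-reflexive-↭ (↭-sym π))

∈⇒↭ : A ∈ Δ → ∃[ Γ ] Δ ↭ A ∷ Γ
∈⇒↭ m with ys , zs , refl ← ∈-∃++ m = ys ++ zs , shift _ ys zs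

GL-premise⊆ : ∀ Φ → Φ ++ □ctx Φ ++ [ □ A ] ⊆ □ A ∷ Φ ++ □ctx Φ
GL-premise⊆ Φ =
  ++-lub Φ (there ∘ xs⊆xs++ys Φ _) (++-lub (□ctx Φ) (there ∘ xs⊆ys++xs _ Φ) λ { (here refl) → here refl })

toSet : Γ ⊢ C → Γ ⊢ˢ C
toSet (Prop _ _ π) = ax (principal π)
toSet (Absurd _ _ π) = ⊥ₗ (principal π)
toSet (∧L _ _ _ _ π d) = ∧ₗ (principal π) (weaken (∷⁺ʳ _ (∷⁺ʳ _ (side π))) (toSet d))
toSet (∧R _ _ _ d e) = ∧ᵣ (toSet d) (toSet e)
toSet (∨L _ _ _ _ π d e) =
  ∨ₗ (principal π) (weaken (∷⁺ʳ _ (side π)) (toSet d)) (weaken (∷⁺ʳ _ (side π)) (toSet e))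
toSet (∨R₀ _ _ _ d) = ∨ᵣ₀ (toSet d)
toSet (∨R₁ _ _ _ d) = ∨ᵣ₁ (toSet d)
toSet (⇒L _ _ _ _ π d e) =
  ⇒ₗ (principal π) (weaken (⊆-reflexive-↭ (↭-sym π)) (toSet d)) (weaken (∷⁺ʳ _ (side π)) (toSet e))
toSet (⇒R _ _ _ d) = ⇒ᵣ (toSet d)
toSet (RGL Π Φ _ π d) =
  □ᵣ Φ (⊆-trans (xs⊆ys++xs _ Π) (⊆-reflexive-↭ (↭-sym π))) (weaken (GL-premise⊆ Φ) (toSet d))

-- The multiset calculus consumes the principal formula of a left rule, while _⊢ˢ_ keeps it;
-- a formula of a set context therefore survives in the multiset context either
-- literally or through what its left rule left behind.
Available : Ctx → Form → Set
Unpacked : Ctx → Form → Set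
Available Δ A = A ∈ Δ ⊎ Unpacked Δ A
Unpacked Δ (A ∧' B) = Available Δ A × Available Δ B
Unpacked Δ (A ∨' B) = Available Δ A ⊎ Available Δ B
Unpacked Δ (A ⇒ B) = Available Δ B
Unpacked Δ _ = ⊥

Covers : Ctx → Ctx → Set
Covers Δ Γ = All (Available Δ) Γ

available-trans : Covers Ψ Δ → Available Δ A → Available Ψ A
available-trans cov (inj₁ m) = All.lookup cov m
available-trans {A = A ∧' B} cov (inj₂ (a , b)) = inj₂ (available-trans cov a , available-trans cov b)
available-trans {A = A ∨' B} cov (inj₂ (inj₁ a)) = inj₂ (inj₁ (available-trans cov a))
available-trans {A = A ∨' B} cov (inj₂ (inj₂ b)) = inj₂ (inj₂ (available-trans cov b))
available-trans {A = A ⇒ B} cov (inj₂ b) = inj₂ (available-trans cov b)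

covers-⊆ : Δ ⊆ Ψ → Covers Ψ Δ
covers-⊆ Δ⊆Ψ = All.tabulate (inj₁ ∘ Δ⊆Ψ)

covers-trans : Covers Ψ Δ → Covers Δ Γ → Covers Ψ Γ
covers-trans cov = All.map (available-trans cov)

covers-replace : Δ ↭ A ∷ Θ → Available Ψ A → Θ ⊆ Ψ → Covers Ψ Δ
covers-replace {A = A} {Θ = Θ} {Ψ = Ψ} π a Θ⊆Ψ = All.tabulate (replace ∘ ∈-resp-↭ π)
  where
  replace : ∀ {B} → B ∈ A ∷ Θ → Available Ψ B
  replace (here refl) = a
  replace (there m) = inj₁ (Θ⊆Ψ m)

available-□ : Available Δ (□ A) → □ A ∈ Δ
available-□ (inj₁ m) = m

fromSet : Γ ⊢ˢ C → Covers Δ Γ → Δ ⊢ C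
fromSet (ax m) cov with All.lookup cov m
... | inj₁ m′ with Θ , π ← ∈⇒↭ m′ = Prop Θ _ π
fromSet (⊥ₗ m) cov with All.lookup cov m
... | inj₁ m′ with Θ , π ← ∈⇒↭ m′ = Absurd Θ _ π
fromSet (∧ₗ m d) cov with All.lookup cov m
... | inj₂ (a , b) = fromSet d (a ∷ b ∷ cov)
... | inj₁ m′ with Θ , π ← ∈⇒↭ m′ =
  ∧L Θ _ _ _ π (fromSet d (a ∷ b ∷ covers-trans (covers-replace π (inj₂ (a , b)) (there ∘ there)) cov))
  where
  a = inj₁ (here refl)
  b = inj₁ (there (here refl))
fromSet (∧ᵣ d e) cov = ∧R _ _ _ (fromSet d cov) (fromSet e cov)
fromSet (∨ₗ m d e) cov with All.lookup cov m
... | inj₂ (inj₁ a) = fromSet d (a ∷ cov)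
... | inj₂ (inj₂ b) = fromSet e (b ∷ cov)
... | inj₁ m′ with Θ , π ← ∈⇒↭ m′ =
  ∨L Θ _ _ _ π (fromSet d (a ∷ covers-trans (covers-replace π (inj₂ (inj₁ a)) there) cov))
               (fromSet e (b ∷ covers-trans (covers-replace π (inj₂ (inj₂ b)) there) cov))
  where
  a = inj₁ (here refl)
  b = inj₁ (here refl)
fromSet (∨ᵣ₀ d) cov = ∨R₀ _ _ _ (fromSet d cov)
fromSet (∨ᵣ₁ d) cov = ∨R₁ _ _ _ (fromSet d cov)
fromSet (⇒ₗ m d e) cov with All.lookup cov m
... | inj₂ b = fromSet e (b ∷ cov)
... | inj₁ m′ with Θ , π ← ∈⇒↭ m′ =
  ⇒L Θ _ _ _ π (fromSet d (covers-trans (covers-⊆ (⊆-reflexive-↭ π)) cov))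
               (fromSet e (b ∷ covers-trans (covers-replace π (inj₂ b) there) cov))
  where b = inj₁ (here refl)
fromSet (⇒ᵣ d) cov = ⇒R _ _ _ (fromSet d (inj₁ (here refl) ∷ covers-trans (covers-⊆ there) cov))
fromSet {Δ = Δ} (□ᵣ {A = A} Φ Φ⊆ d) cov =
  RGL (nonboxed Δ) U A (split-boxes Δ) (fromSet d (covers-⊆ premise⊆))
  where
  U = unbox Δ
  Φ⊆U : Φ ⊆ U
  Φ⊆U = ∈-unbox⁺ ∘ available-□ ∘ All.lookup cov ∘ Φ⊆ ∘ ∈-map⁺ □_
  premise⊆ : □ A ∷ Φ ++ □ctx Φ ⊆ U ++ □ctx U ++ [ □ A ]
  premise⊆ = ∈-∷⁺ʳ (∈-++⁺ʳ U (∈-++⁺ʳ (□ctx U) (here refl)))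
                   (⊆-trans (++⁺ Φ⊆U (map⁺ □_ Φ⊆U)) (++⁺ʳ U (xs⊆xs++ys _ _)))

-- Cut

missingBoxes : Ctx → Ctx → ℕ
missingBoxes L Γ = length (filter (λ A → ¬? (□ A ∈? Γ)) L)

missingBoxes-mono : ∀ L → (∀ {A} → □ A ∈ Γ → □ A ∈ Δ) → missingBoxes L Δ ≤ missingBoxes L Γ
missingBoxes-mono L boxes⊆ = length-filter-mono _ _ (λ ∉Δ → ∉Δ ∘ boxes⊆) L

missingBoxes-strict : ∀ L → (∀ {A} → □ A ∈ Γ → □ A ∈ Δ) → A ∈ L → □ A ∈ Δ → □ A ∉ Γ →
                      missingBoxes L Δ < missingBoxes L Γ
missingBoxes-strict L boxes⊆ A∈L ∈Δ ∉Γ =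
  length-filter-strict _ _ (λ ∉Δ → ∉Δ ∘ boxes⊆) (Any.map (λ { refl → ∉Γ , λ ∉Δ → ∉Δ ∈Δ }) A∈L)

CutAdmissible : Form → Set
CutAdmissible K = ∀ {Γ C} → Γ ⊢ˢ K → K ∷ Γ ⊢ˢ C → Γ ⊢ˢ C

Below : Form → Set
Below K = ∀ {A} → A ≺ K → CutAdmissible A

data RightRule (Γ : Ctx) : Form → Set where
  ax  : ∀ {p} → var p ∈ Γ → RightRule Γ (var p)
  ∧ᵣ  : Γ ⊢ˢ A → Γ ⊢ˢ B → RightRule Γ (A ∧' B)
  ∨ᵣ₀ : Γ ⊢ˢ A → RightRule Γ (A ∨' B)
  ∨ᵣ₁ : Γ ⊢ˢ B → RightRule Γ (A ∨' B)
  ⇒ᵣ  : A ∷ Γ ⊢ˢ B → RightRule Γ (A ⇒ B)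
  □ᵣ  : ∀ Φ → □ctx Φ ⊆ Γ → □ A ∷ Φ ++ □ctx Φ ⊢ˢ A → RightRule Γ (□ A)

⊆-swap : A ∷ B ∷ Γ ⊆ B ∷ A ∷ Γ
⊆-swap = ⊆-reflexive-↭ (swap _ _ ↭-refl)

⊆-under : Θ ⊆ K ∷ Γ → A ∷ Θ ⊆ K ∷ A ∷ Γ
⊆-under Θ⊆ = ⊆-trans (∷⁺ʳ _ Θ⊆) ⊆-swap

module Reduction (L : Ctx) (closed : SubformulaClosed L) where

  viaRightRule : Γ ⊢ˢ K → Γ ⊆ L → (∀ {Ψ} → Γ ⊆ Ψ → Ψ ⊆ L → RightRule Ψ K → Ψ ⊢ˢ C) → Γ ⊢ˢ C
  viaRightRule (ax m) Γ⊆L k = k ⊆-refl Γ⊆L (ax m)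
  viaRightRule (⊥ₗ m) _ _ = ⊥ₗ m
  viaRightRule (∧ₗ m d) Γ⊆L k =
    ∧ₗ m (viaRightRule d (∈-∷⁺ʳ (closed ≺∧ˡ (Γ⊆L m)) (∈-∷⁺ʳ (closed ≺∧ʳ (Γ⊆L m)) Γ⊆L))
                         (λ Γ⊆Ψ → k (Γ⊆Ψ ∘ there ∘ there)))
  viaRightRule (∧ᵣ d e) Γ⊆L k = k ⊆-refl Γ⊆L (∧ᵣ d e)
  viaRightRule (∨ₗ m d e) Γ⊆L k =
    ∨ₗ m (viaRightRule d (∈-∷⁺ʳ (closed ≺∨ˡ (Γ⊆L m)) Γ⊆L) (λ Γ⊆Ψ → k (Γ⊆Ψ ∘ there)))
         (viaRightRule e (∈-∷⁺ʳ (closed ≺∨ʳ (Γ⊆L m)) Γ⊆L) (λ Γ⊆Ψ → k (Γ⊆Ψ ∘ there)))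
  viaRightRule (∨ᵣ₀ d) Γ⊆L k = k ⊆-refl Γ⊆L (∨ᵣ₀ d)
  viaRightRule (∨ᵣ₁ d) Γ⊆L k = k ⊆-refl Γ⊆L (∨ᵣ₁ d)
  viaRightRule (⇒ₗ m d e) Γ⊆L k =
    ⇒ₗ m d (viaRightRule e (∈-∷⁺ʳ (closed ≺⇒ʳ (Γ⊆L m)) Γ⊆L) (λ Γ⊆Ψ → k (Γ⊆Ψ ∘ there)))
  viaRightRule (⇒ᵣ d) Γ⊆L k = k ⊆-refl Γ⊆L (⇒ᵣ d)
  viaRightRule (□ᵣ Φ Φ⊆ d) Γ⊆L k = k ⊆-refl Γ⊆L (□ᵣ Φ Φ⊆ d)

  record Left (K : Form) (n : ℕ) (Γ : Ctx) : Set where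
    field
      derivation : Γ ⊢ˢ K
      ⊆L         : K ∷ Γ ⊆ L
      bound      : missingBoxes L Γ ≤ n

    Γ⊆L : Γ ⊆ L
    Γ⊆L = ⊆L ∘ there

  open Left

  extend : A ∈ L → Left K n Γ → Left K n (A ∷ Γ)
  extend A∈L left = record
    { derivation = weaken (xs⊆x∷xs _ _) (derivation left)
    ; ⊆L         = ⊆-trans ⊆-swap (∈-∷⁺ʳ A∈L (⊆L left))
    ; bound      = ≤-trans (missingBoxes-mono L there) (bound left)
    }

  ∧ₗ-cut : Below K → Γ ⊢ˢ K → Γ ⊆ L → A ∧' B ∈ K ∷ Γ → A ∷ B ∷ Γ ⊢ˢ C → Γ ⊢ˢ C
  ∧ₗ-cut ih d Γ⊆L (there m) e = ∧ₗ m e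
  ∧ₗ-cut ih d Γ⊆L (here refl) e = viaRightRule d Γ⊆L λ where
    Γ⊆Ψ _ (∧ᵣ a b) → ih ≺∧ˡ a (ih ≺∧ʳ (weaken there b) (weaken (⊆-trans (∷⁺ʳ _ (∷⁺ʳ _ Γ⊆Ψ)) ⊆-swap) e))

  ∨ₗ-cut : Below K → Γ ⊢ˢ K → Γ ⊆ L → A ∨' B ∈ K ∷ Γ → A ∷ Γ ⊢ˢ C → B ∷ Γ ⊢ˢ C → Γ ⊢ˢ C
  ∨ₗ-cut ih d Γ⊆L (there m) e f = ∨ₗ m e f
  ∨ₗ-cut ih d Γ⊆L (here refl) e f = viaRightRule d Γ⊆L λ where
    Γ⊆Ψ _ (∨ᵣ₀ a) → ih ≺∨ˡ a (weaken (∷⁺ʳ _ Γ⊆Ψ) e)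
    Γ⊆Ψ _ (∨ᵣ₁ b) → ih ≺∨ʳ b (weaken (∷⁺ʳ _ Γ⊆Ψ) f)

  ⇒ₗ-cut : Below K → Γ ⊢ˢ K → Γ ⊆ L → A ⇒ B ∈ K ∷ Γ → Γ ⊢ˢ A → B ∷ Γ ⊢ˢ C → Γ ⊢ˢ C
  ⇒ₗ-cut ih d Γ⊆L (there m) e f = ⇒ₗ m e f
  ⇒ₗ-cut ih d Γ⊆L (here refl) e f = viaRightRule d Γ⊆L λ where
    Γ⊆Ψ _ (⇒ᵣ g) → ih ≺⇒ʳ (ih ≺⇒ˡ (weaken Γ⊆Ψ e) g) (weaken (∷⁺ʳ _ Γ⊆Ψ) f)

  cut≤ : Below K → Left K n Γ → Θ ⊢ˢ C → Θ ⊆ K ∷ Γ → C ∈ L → Γ ⊢ˢ C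
  cut< : Below K → Γ ⊢ˢ K → K ∷ Γ ⊆ L → missingBoxes L Γ < n → Θ ⊢ˢ C → Θ ⊆ K ∷ Γ → C ∈ L → Γ ⊢ˢ C
  □ᵣ-cut : Below K → Left K n Γ → ∀ Φ → □ctx Φ ⊆ K ∷ Γ → □ D ∷ Φ ++ □ctx Φ ⊢ˢ D → □ D ∈ L → Γ ⊢ˢ □ D
  □□-cut : Below (□ E) → □ E ∈ L → missingBoxes L Ψ ≤ n → Ψ ⊆ L →
           ∀ Φ → □ctx Φ ⊆ □ E ∷ Ψ → □ D ∷ Φ ++ □ctx Φ ⊢ˢ D → □ D ∈ L →
           ∀ Φ′ → □ctx Φ′ ⊆ Ψ → □ E ∷ Φ′ ++ □ctx Φ′ ⊢ˢ E → Ψ ⊢ˢ □ D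

  cut≤ ih left (ax m) Θ⊆ c with Θ⊆ m
  ... | here refl = derivation left
  ... | there m′ = ax m′
  cut≤ ih left (⊥ₗ m) Θ⊆ c with Θ⊆ m
  ... | here refl = viaRightRule (derivation left) (Γ⊆L left) λ _ _ ()
  ... | there m′ = ⊥ₗ m′
  cut≤ ih left (∧ₗ m e) Θ⊆ c =
    ∧ₗ-cut ih (derivation left) (Γ⊆L left) (Θ⊆ m)
      (cut≤ ih (extend (closed ≺∧ˡ A∧B∈L) (extend (closed ≺∧ʳ A∧B∈L) left)) e (⊆-under (⊆-under Θ⊆)) c)
    where A∧B∈L = ⊆L left (Θ⊆ m)
  cut≤ ih left (∧ᵣ d e) Θ⊆ c = ∧ᵣ (cut≤ ih left d Θ⊆ (closed ≺∧ˡ c)) (cut≤ ih left e Θ⊆ (closed ≺∧ʳ c))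
  cut≤ ih left (∨ₗ m e f) Θ⊆ c =
    ∨ₗ-cut ih (derivation left) (Γ⊆L left) (Θ⊆ m)
      (cut≤ ih (extend (closed ≺∨ˡ A∨B∈L) left) e (⊆-under Θ⊆) c)
      (cut≤ ih (extend (closed ≺∨ʳ A∨B∈L) left) f (⊆-under Θ⊆) c)
    where A∨B∈L = ⊆L left (Θ⊆ m)
  cut≤ ih left (∨ᵣ₀ d) Θ⊆ c = ∨ᵣ₀ (cut≤ ih left d Θ⊆ (closed ≺∨ˡ c))
  cut≤ ih left (∨ᵣ₁ d) Θ⊆ c = ∨ᵣ₁ (cut≤ ih left d Θ⊆ (closed ≺∨ʳ c))
  cut≤ ih left (⇒ₗ m e f) Θ⊆ c =
    ⇒ₗ-cut ih (derivation left) (Γ⊆L left) (Θ⊆ m)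
      (cut≤ ih left e Θ⊆ (closed ≺⇒ˡ A⇒B∈L))
      (cut≤ ih (extend (closed ≺⇒ʳ A⇒B∈L) left) f (⊆-under Θ⊆) c)
    where A⇒B∈L = ⊆L left (Θ⊆ m)
  cut≤ ih left (⇒ᵣ d) Θ⊆ c = ⇒ᵣ (cut≤ ih (extend (closed ≺⇒ˡ c) left) d (⊆-under Θ⊆) (closed ≺⇒ʳ c))
  cut≤ ih left (□ᵣ Φ Φ⊆ d) Θ⊆ c = □ᵣ-cut ih left Φ (⊆-trans Φ⊆ Θ⊆) d c

  cut< {n = suc n} ih d ⊆L (s≤s b) = cut≤ ih record { derivation = d ; ⊆L = ⊆L ; bound = b }

  □ᵣ-cut {K = K} ih left Φ Φ⊆ d c with boxView K
  ... | unboxed K≢□ = □ᵣ Φ (⊆∷∧∉⇒⊆ Φ⊆ K∉□Φ) d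
    where
    K∉□Φ : K ∉ □ctx Φ
    K∉□Φ K∈ with A , _ , eq ← ∈-map⁻ □_ K∈ = K≢□ A eq
  ... | boxed E = viaRightRule (derivation left) (Γ⊆L left) λ where
    Γ⊆Ψ Ψ⊆L (□ᵣ Φ′ Φ′⊆ q) →
      □□-cut ih (⊆L left (here refl)) (≤-trans (missingBoxes-mono L Γ⊆Ψ) (bound left)) Ψ⊆L
             Φ (⊆-trans Φ⊆ (∷⁺ʳ _ Γ⊆Ψ)) d c Φ′ Φ′⊆ q

  □□-cut {E = E} {Ψ = Ψ} {n = n} {D = D} ih E∈L b Ψ⊆L Φ Φ⊆ d c Φ′ Φ′⊆ q with □ D ∈? Ψ
  ... | yes □D∈Ψ = identity (□ D) □D∈Ψ
  ... | no □D∉Ψ = □ᵣ U □ctx-unbox⊆ (ih ≺□ ⊢E ⊢D)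
    where
    U = unbox Ψ
    Ψ′ = □ D ∷ U ++ □ctx U
    Ψ′⊆L : Ψ′ ⊆ L
    Ψ′⊆L = ∈-∷⁺ʳ c (++-lub U (closed ≺□ ∘ Ψ⊆L ∘ ∈-unbox⁻) (Ψ⊆L ∘ □ctx-unbox⊆))
    shrinks : missingBoxes L Ψ′ < n
    shrinks = <-≤-trans (missingBoxes-strict L (there ∘ ∈-++⁺ʳ U ∘ ∈-map⁺ □_ ∘ ∈-unbox⁺)
                                             (closed ≺□ c) (here refl) □D∉Ψ) b
    Φ′⊆U : Φ′ ⊆ U
    Φ′⊆U = □ctx⊆⇒⊆unbox Φ′⊆
    ⊢□E : Ψ′ ⊢ˢ □ E
    ⊢□E = □ᵣ Φ′ (there ∘ ∈-++⁺ʳ U ∘ map⁺ □_ Φ′⊆U) q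
    ⊢E : Ψ′ ⊢ˢ E
    ⊢E = cut< ih ⊢□E (∈-∷⁺ʳ E∈L Ψ′⊆L) shrinks
              q (∷⁺ʳ _ (there ∘ ++⁺ Φ′⊆U (map⁺ □_ Φ′⊆U))) (closed ≺□ E∈L)
    -- unbox (□ E ∷ Ψ) computes to E ∷ U.
    Φ⊆EU : Φ ⊆ E ∷ U
    Φ⊆EU = □ctx⊆⇒⊆unbox Φ⊆
    premise⊆ : □ D ∷ Φ ++ □ctx Φ ⊆ □ E ∷ E ∷ Ψ′
    premise⊆ = ∈-∷⁺ʳ (there (there (here refl)))
      (++-lub Φ (there ∘ ∷⁺ʳ E (there ∘ xs⊆xs++ys U _) ∘ Φ⊆EU)
              (∷⁺ʳ (□ E) (there ∘ there ∘ ∈-++⁺ʳ U) ∘ map⁺ □_ Φ⊆EU))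
    ⊢D : E ∷ Ψ′ ⊢ˢ D
    ⊢D = cut< ih (weaken there ⊢□E) (∈-∷⁺ʳ E∈L (∈-∷⁺ʳ (closed ≺□ E∈L) Ψ′⊆L))
              (≤-<-trans (missingBoxes-mono L there) shrinks) d premise⊆ (closed ≺□ c)

cut : ∀ K → CutAdmissible K
below : Below K

cut K {Γ} {C} d e = cut≤ below left e ⊆-refl (⊆-subformulasOf (K ∷ C ∷ Γ) (there (here refl)))
  where
  open Reduction (subformulasOf (K ∷ C ∷ Γ)) (subformulasOf-closed (K ∷ C ∷ Γ))
  left : Left K (missingBoxes (subformulasOf (K ∷ C ∷ Γ)) Γ) Γ
  left = record
    { derivation = d ; ⊆L = ⊆-subformulasOf (K ∷ C ∷ Γ) ∘ ∷⁺ʳ K (xs⊆x∷xs Γ C) ; bound = ≤-refl }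

below {A = A} ≺⇒ˡ = cut A
below {A = A} ≺⇒ʳ = cut A
below {A = A} ≺∧ˡ = cut A
below {A = A} ≺∧ʳ = cut A
below {A = A} ≺∨ˡ = cut A
below {A = A} ≺∨ʳ = cut A
below {A = A} ≺□ = cut A

löb : □ctx Φ ⊆ Γ → Θ ⊆ □ A ∷ Φ ++ □ctx Φ → Θ ⊆ □ A ∷ Γ → Θ ⊢ˢ A → Γ ⊢ˢ A
löb {Φ = Φ} {A = A} Φ⊆Γ Θ⊆premise Θ⊆□A∷Γ d = cut (□ A) (□ᵣ Φ Φ⊆Γ (weaken Θ⊆premise d)) (weaken Θ⊆□A∷Γ d)

mainTheorem1 : (Γ Δ : List Form) (φ : Form) →
    (Γ ++ □ctx Γ ++ □ctx Δ ++ (□ φ ∷ [])) ⊢ φ →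
    (Γ ++ □ctx Γ ++ □ctx Δ) ⊢ φ
mainTheorem1 Γ Δ φ d = fromSet (löb boxes⊆ ⊆premise ⊆□φ∷ (toSet d)) (covers-⊆ ⊆-refl)
  where
  □ΓΔ : □ctx (Γ ++ Δ) ⊆ □ctx Γ ++ □ctx Δ
  □ΓΔ = ⊆-reflexive (map-++ □_ Γ Δ)
  boxes⊆ : □ctx (Γ ++ Δ) ⊆ Γ ++ □ctx Γ ++ □ctx Δ
  boxes⊆ = xs⊆ys++xs _ Γ ∘ □ΓΔ
  ⊆premise : Γ ++ □ctx Γ ++ □ctx Δ ++ [ □ φ ] ⊆ □ φ ∷ (Γ ++ Δ) ++ □ctx (Γ ++ Δ)
  ⊆premise = ++-lub Γ (there ∘ xs⊆xs++ys _ _ ∘ xs⊆xs++ys Γ Δ)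
            (++-lub (□ctx Γ) (there ∘ xs⊆ys++xs _ (Γ ++ Δ) ∘ map⁺ □_ (xs⊆xs++ys Γ Δ))
            (++-lub (□ctx Δ) (there ∘ xs⊆ys++xs _ (Γ ++ Δ) ∘ map⁺ □_ (xs⊆ys++xs Δ Γ))
                    λ { (here refl) → here refl }))
  ⊆□φ∷ : Γ ++ □ctx Γ ++ □ctx Δ ++ [ □ φ ] ⊆ □ φ ∷ Γ ++ □ctx Γ ++ □ctx Δ
  ⊆□φ∷ = ++-lub Γ (there ∘ xs⊆xs++ys Γ _)
        (++-lub (□ctx Γ) (there ∘ xs⊆ys++xs _ Γ ∘ xs⊆xs++ys _ _)
        (++-lub (□ctx Δ) (there ∘ xs⊆ys++xs _ Γ ∘ xs⊆ys++xs _ _)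
                λ { (here refl) → here refl }))
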